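{- Let $k \ge 2$ be an even integer and let $D$ be a $k$-quasi-transitive digraph with a unique initial strong component $C$. If $v \in V(C)$ satisfies $\Delta_C^+ \ge d_C^+(v) > \Delta_C^+ - k$, then $v$ is a $(k+1)$-king of $D$.
   Context: All digraphs are finite, without loops and without multiple arcs in the same direction; paths are directed. For $u,v \in V(D)$, $d(u,v)$ is the length of a shortest directed $uv$-path ($\infty$ if none, $d(v,v)=0$). A vertex $v$ is an $r$-king of $D$ if $d(v,u) \le r$ for every $u \in V(D)$. $D$ is $k$-quasi-transitive if for every directed path $(v_0, \dots, v_k)$ of length $k$, $(v_0,v_k) \in A(D)$ or $(v_k,v_0) \in A(D)$. An initial strong component is a strong component with no arc entering it from outside. Here $C$ is regarded as the subdigraph of $D$ it induces; $d_C^+(v)$ is the out-degree of $v$ in $C$ and $\Delta_C^+$ is the maximum out-degree of a vertex in $C$. -}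

module Defs where

open import Data.Nat using (ℕ; suc; _≤_; _⊔_)
open import Data.Bool using (Bool; true; false; T)
open import Data.Fin using (Fin; zero; suc; inject₁; fromℕ)
open import Data.Fin.Subset using (Subset; _∈_; _∉_; _∩_; ∣_∣)
open import Data.Fin.Subset.Properties using (_∈?_)
open import Data.List using (List; foldr; map; filter)
open import Data.List.Base using ()
open import Data.Fin.Base using ()
open import Data.Vec using (tabulate)
open import Data.Product using (Σ; ∃; _×_)
open import Function.Definitions using (Injective)
open import Relation.Binary.PropositionalEquality using (_≡_)
open import Data.List using () renaming (map to lmap)
open import Data.Fin.Subset using (Nonempty)
import Data.List as L
open import Data.Fin using () renaming (Fin to F)

record Digraph (n : ℕ) : Set where
  field
    arc      : Fin n → Fin n → Bool
    loopless : ∀ v → arc v v ≡ false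

module _ {n : ℕ} (D : Digraph n) where
  open Digraph D

  Arc : Fin n → Fin n → Set
  Arc u v = T (arc u v)

  record Path (ℓ : ℕ) (u v : Fin n) : Set where
    field
      vert  : Fin (suc ℓ) → Fin n
      inj   : Injective _≡_ _≡_ vert
      start : vert zero ≡ u
      end   : vert (fromℕ ℓ) ≡ v
      step  : ∀ (i : Fin ℓ) → Arc (vert (inject₁ i)) (vert (suc i))

  -- d(u,v) ≤ r : some directed uv-path has length at most r
  -- (d(v,v)=0 is realised by the trivial path of length 0).
  DistLe : Fin n → Fin n → ℕ → Set
  DistLe u v r = Σ ℕ λ ℓ → ℓ ≤ r × Path ℓ u v

  Reach : Fin n → Fin n → Set
  Reach u v = Σ ℕ λ ℓ → Path ℓ u v

  King : ℕ → Fin n → Set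
  King r v = ∀ u → DistLe v u r

  QuasiTransitive : ℕ → Set
  QuasiTransitive k = ∀ {u v} → Path k u v → Arc u v ⊎' Arc v u
    where
    open import Data.Sum using () renaming (_⊎_ to _⊎'_)

  IsStrongComponent : Subset n → Set
  IsStrongComponent C =
    Nonempty C ×
    (∀ {x y} → x ∈ C → y ∈ C → Reach x y) ×
    (∀ {x z} → x ∈ C → Reach x z → Reach z x → z ∈ C)

  IsInitial : Subset n → Set
  IsInitial C = ∀ {x y} → x ∉ C → y ∈ C → Arc x y → ⊥'
    where
    open import Data.Empty using () renaming (⊥ to ⊥')

  IsInitialStrongComponent : Subset n → Set
  IsInitialStrongComponent C = IsStrongComponent C × IsInitial C

  UniqueInitialStrongComponent : Subset n → Set
  UniqueInitialStrongComponent C =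
    IsInitialStrongComponent C × (∀ C′ → IsInitialStrongComponent C′ → C′ ≡ C)

  OutNbhd : Fin n → Subset n
  OutNbhd v = tabulate (arc v)

  outDegIn : Subset n → Fin n → ℕ
  outDegIn C v = ∣ C ∩ OutNbhd v ∣

  maxOutDegIn : Subset n → ℕ
  maxOutDegIn C =
    foldr _⊔_ 0 (map (outDegIn C) (filter (_∈? C) (L.allFin n)))

module Submission where

-- Since v lies in the unique initial strong component, it reaches every vertex.  If some
-- vertex were at distance more than k + 1 from v, some W would be at distance exactly
-- k + 2, along a shortest path v = x₀, …, x_{k+2} = W.  Quasi-transitivity on x₀ … x_k
-- gives the arc x_k → x₀ (the other direction would shorten the path), so x₀ … x_k is a
-- cycle of odd length k + 1; on x₂ … x_{k+2} it gives W → x₂.  Applied to W followed by k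
-- consecutive cycle vertices it shows that W → x_{j+2} implies W → x_j (indices mod k + 1),
-- so W dominates the whole cycle because k + 1 is odd; applied to W, x₃, …, x_k, x₀, y it
-- shows W → y for every out-neighbour y of v.  Hence the out-neighbourhood of W in C
-- contains that of v and also x₀, x₂, …, x_k, none of which is an out-neighbour of v, so
-- d⁺_C(W) ≥ d⁺_C(v) + k > Δ⁺_C, which is absurd.

open import Defs
open import Data.Bool using (Bool; T)
open import Data.Bool.Properties using (T-≡)
open import Data.Empty using (⊥; ⊥-elim)
open import Data.Fin using (Fin; zero; suc; toℕ)
open import Data.Fin.Properties
  using (toℕ-injective; toℕ<n; toℕ-fromℕ; toℕ-inject₁; injective⇒≤; any?)
  renaming (_≟_ to _≟ᶠ_; suc-injective to Fin-suc-injective)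
open import Data.Fin.Subset using (Subset; _∈_; _∉_; _⊆_; _⊂_; _∪_; _∩_; ⁅_⁆; ∣_∣)
open import Data.Fin.Subset.Properties
  using (p⊂q⇒∣p∣<∣q∣; p⊆q⇒∣p∣≤∣q∣; p⊆p∪q; q⊆p∪q; x∈⁅x⁆; x∈⁅y⁆⇒x≡y; x∈p∪q⁻; x∈p∩q⁺; x∈p∩q⁻; _∈?_)
open import Data.List using (allFin)
open import Data.List.Properties using (foldr-preservesᵒ)
import Data.List.Relation.Unary.Any as Any
open import Data.List.Relation.Unary.Any.Properties using (map⁺)
open import Data.List.Membership.Propositional.Properties using (∈-allFin; ∈-filter⁺)
open import Data.Nat using (ℕ; zero; suc; _≤_; _<_; _+_; _*_; _∸_; z≤n; s≤s; _≤?_; NonZero)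
open import Data.Nat.Divisibility using (_∣_; divides)
open import Data.Nat.DivMod using (_%_; _/_; m≡m%n+[m/n]*n; /-monoˡ-≤; m%n<n; m≤n⇒m%n≡m; m*n%n≡0;
                                  [m+n]%n≡m%n; m%n%n≡m%n; %-distribˡ-+)
open import Data.Nat.Induction using (<-rec; <-wellFounded)
open import Data.Nat.Properties
open import Data.Product using (Σ; ∃; _×_; _,_; proj₁; proj₂)
open import Data.Sum using (_⊎_; inj₁; inj₂; [_,_]′)
open import Data.Vec using (tabulate)
open import Data.Vec.Properties using (lookup∘tabulate; []=⇒lookup; lookup⇒[]=)
open import Function using (_∘_)
open import Function.Bundles using (Equivalence)
open import Induction.WellFounded using (module All)
open import Level using (0ℓ)
import Relation.Binary.Construct.On as On
open import Relation.Binary.PropositionalEquality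
open import Relation.Nullary using (¬_; Dec; yes; no; contradiction)
open import Relation.Nullary.Decidable
  using (T?; _×-dec_; map′; ¬?; isYes; toWitness; fromWitness; decidable-stable)

module _ {A : Set} where

  InjectiveOn : (ℕ → A) → ℕ → Set
  InjectiveOn f L = ∀ {i j} → i ≤ L → j ≤ L → f i ≡ f j → i ≡ j

  injectiveOn-≤ : ∀ {f L M} → M ≤ L → InjectiveOn f L → InjectiveOn f M
  injectiveOn-≤ M≤L inj i≤M j≤M = inj (≤-trans i≤M M≤L) (≤-trans j≤M M≤L)

  injectiveOn-shift : ∀ {f} a {L} → InjectiveOn f (a + L) → InjectiveOn (λ i → f (a + i)) L
  injectiveOn-shift a inj i≤L j≤L eq =
    +-cancelˡ-≡ a _ _ (inj (+-monoʳ-≤ a i≤L) (+-monoʳ-≤ a j≤L) eq)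

  _◂_ : A → (ℕ → A) → ℕ → A
  (a ◂ f) zero    = a
  (a ◂ f) (suc i) = f i

  ◂-injectiveOn : ∀ {a f L} → (∀ {i} → i ≤ L → a ≢ f i) → InjectiveOn f L →
                  InjectiveOn (a ◂ f) (suc L)
  ◂-injectiveOn a∉f inj {zero}  {zero}  _         _         _  = refl
  ◂-injectiveOn a∉f inj {zero}  {suc j} _         (s≤s j≤L) eq = ⊥-elim (a∉f j≤L eq)
  ◂-injectiveOn a∉f inj {suc i} {zero}  (s≤s i≤L) _         eq = ⊥-elim (a∉f i≤L (sym eq))
  ◂-injectiveOn a∉f inj {suc i} {suc j} (s≤s i≤L) (s≤s j≤L) eq = cong suc (inj i≤L j≤L eq)

  snoc : (ℕ → A) → ℕ → A → ℕ → A
  snoc f L a i with i ≤? L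
  ... | yes _ = f i
  ... | no  _ = a

  snoc-≤ : ∀ f {L} a {i} → i ≤ L → snoc f L a i ≡ f i
  snoc-≤ f {L} a {i} i≤L with i ≤? L
  ... | yes _   = refl
  ... | no  i≰L = contradiction i≤L i≰L

  snoc-last : ∀ f L a → snoc f L a (suc L) ≡ a
  snoc-last f L a with suc L ≤? L
  ... | yes 1+L≤L = contradiction 1+L≤L (n≮n L)
  ... | no  _     = refl

  snoc-elim : ∀ (P : A → Set) {f L a i} → i ≤ suc L →
              (∀ {j} → j ≤ L → P (f j)) → P a → P (snoc f L a i)
  snoc-elim P {f} {L} {a} {i} i≤1+L Pf Pa with m≤n⇒m<n∨m≡n i≤1+L
  ... | inj₁ (s≤s i≤L) = subst P (sym (snoc-≤ f a i≤L)) (Pf i≤L)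
  ... | inj₂ refl      = subst P (sym (snoc-last f L a)) Pa

  snoc-injectiveOn : ∀ {f L a} → (∀ {i} → i ≤ L → f i ≢ a) → InjectiveOn f L →
                     InjectiveOn (snoc f L a) (suc L)
  snoc-injectiveOn {f} {L} {a} f∌a inj {i} {j} i≤1+L j≤1+L eq
    with m≤n⇒m<n∨m≡n i≤1+L | m≤n⇒m<n∨m≡n j≤1+L
  ... | inj₁ (s≤s i≤L) | inj₁ (s≤s j≤L) =
    inj i≤L j≤L (trans (sym (snoc-≤ f a i≤L)) (trans eq (snoc-≤ f a j≤L)))
  ... | inj₁ (s≤s i≤L) | inj₂ refl =
    ⊥-elim (f∌a i≤L (trans (sym (snoc-≤ f a i≤L)) (trans eq (snoc-last f L a))))
  ... | inj₂ refl | inj₁ (s≤s j≤L) =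
    ⊥-elim (f∌a j≤L (trans (sym (snoc-≤ f a j≤L)) (trans (sym eq) (snoc-last f L a))))
  ... | inj₂ refl | inj₂ refl = refl

%-injectiveOnWindow : ∀ {N i j} .{{_ : NonZero N}} → i ≤ j → j < i + N → i % N ≡ j % N → i ≡ j
%-injectiveOnWindow {N} {i} {j} i≤j j<i+N i≡j[N] with m≤n⇒m<n∨m≡n (/-monoˡ-≤ N i≤j)
... | inj₂ i/N≡j/N = begin
  i                  ≡⟨ m≡m%n+[m/n]*n i N ⟩
  i % N + i / N * N  ≡⟨ cong₂ (λ r q → r + q * N) i≡j[N] i/N≡j/N ⟩
  j % N + j / N * N  ≡⟨ m≡m%n+[m/n]*n j N ⟨
  j                  ∎
  where open ≡-Reasoning
... | inj₁ i/N<j/N = contradiction j<i+N (≤⇒≯ (begin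
  i + N                     ≡⟨ cong (_+ N) (m≡m%n+[m/n]*n i N) ⟩
  i % N + i / N * N + N     ≡⟨ +-assoc (i % N) _ N ⟩
  i % N + (i / N * N + N)   ≡⟨ cong (i % N +_) (+-comm _ N) ⟩
  i % N + suc (i / N) * N   ≡⟨ cong (_+ suc (i / N) * N) i≡j[N] ⟩
  j % N + suc (i / N) * N   ≤⟨ +-monoʳ-≤ (j % N) (*-monoˡ-≤ N i/N<j/N) ⟩
  j % N + j / N * N         ≡⟨ m≡m%n+[m/n]*n j N ⟨
  j                         ∎))
  where open ≤-Reasoning

∣p∣+m≤∣q∣ : ∀ {n} m (f : ℕ → Fin n) {p q : Subset n} → p ⊆ q →
            (∀ {i} → i < m → f i ∈ q) → (∀ {i} → i < m → f i ∉ p) →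
            (∀ {i j} → i < m → j < m → f i ≡ f j → i ≡ j) →
            ∣ p ∣ + m ≤ ∣ q ∣
∣p∣+m≤∣q∣ zero    f {p} p⊆q _ _ _ = ≤-trans (≤-reflexive (+-identityʳ ∣ p ∣)) (p⊆q⇒∣p∣≤∣q∣ p⊆q)
∣p∣+m≤∣q∣ (suc m) f {p} {q} p⊆q f∈q f∉p f-inj = begin
  ∣ p ∣ + suc m         ≡⟨ +-suc ∣ p ∣ m ⟩
  suc ∣ p ∣ + m         ≤⟨ +-monoˡ-≤ m (p⊂q⇒∣p∣<∣q∣ p⊂p′) ⟩
  ∣ p ∪ ⁅ f m ⁆ ∣ + m   ≤⟨ ∣p∣+m≤∣q∣ m f p′⊆q (λ i<m → f∈q (m<n⇒m<1+n i<m)) f∉p′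
                            (λ i<m j<m → f-inj (m<n⇒m<1+n i<m) (m<n⇒m<1+n j<m)) ⟩
  ∣ q ∣                 ∎
  where
  open ≤-Reasoning
  p⊂p′ : p ⊂ p ∪ ⁅ f m ⁆
  p⊂p′ = p⊆p∪q _ , f m , q⊆p∪q p _ (x∈⁅x⁆ (f m)) , f∉p ≤-refl
  p′⊆q : p ∪ ⁅ f m ⁆ ⊆ q
  p′⊆q x∈ with x∈p∪q⁻ p _ x∈
  ... | inj₁ x∈p   = p⊆q x∈p
  ... | inj₂ x∈fm = subst (_∈ q) (sym (x∈⁅y⁆⇒x≡y _ x∈fm)) (f∈q ≤-refl)
  f∉p′ : ∀ {i} → i < m → f i ∉ p ∪ ⁅ f m ⁆
  f∉p′ {i} i<m fi∈ with x∈p∪q⁻ p _ fi∈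
  ... | inj₁ fi∈p  = f∉p (m<n⇒m<1+n i<m) fi∈p
  ... | inj₂ fi∈fm = <⇒≢ i<m (f-inj (m<n⇒m<1+n i<m) ≤-refl (x∈⁅y⁆⇒x≡y _ fi∈fm))

∈-tabulate⁺ : ∀ {n} {f : Fin n → Bool} {x} → T (f x) → x ∈ tabulate f
∈-tabulate⁺ {f = f} {x} t =
  lookup⇒[]= x (tabulate f) (trans (lookup∘tabulate f x) (Equivalence.to T-≡ t))

∈-tabulate⁻ : ∀ {n} {f : Fin n → Bool} {x} → x ∈ tabulate f → T (f x)
∈-tabulate⁻ {f = f} {x} x∈ =
  Equivalence.from T-≡ (trans (sym (lookup∘tabulate f x)) ([]=⇒lookup x∈))

outDegIn≤maxOutDegIn : ∀ {n} (D : Digraph n) (C : Subset n) {u} → u ∈ C →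
                       outDegIn D C u ≤ maxOutDegIn D C
outDegIn≤maxOutDegIn D C {u} u∈C =
  foldr-preservesᵒ {P = outDegIn D C u ≤_} (λ x y → [ m≤n⇒m≤n⊔o y , m≤n⇒m≤o⊔n x ]′) 0 _
    (inj₂ (map⁺ (Any.map (λ { refl → ≤-refl }) (∈-filter⁺ (_∈? C) (∈-allFin u) u∈C))))

module _ {n : ℕ} (D : Digraph n) where

  private
    variable
      u v w : Fin n
      ℓ m : ℕ

  Chain : (ℕ → Fin n) → ℕ → Set
  Chain f L = ∀ {i} → i < L → Arc D (f i) (f (suc i))

  chain-≤ : ∀ {f L M} → M ≤ L → Chain f L → Chain f M
  chain-≤ M≤L ch i<M = ch (<-≤-trans i<M M≤L)

  chain-shift : ∀ {f} a {L} → Chain f (a + L) → Chain (λ i → f (a + i)) L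
  chain-shift {f} a ch {i} i<L =
    subst (λ j → Arc D (f (a + i)) (f j)) (sym (+-suc a i)) (ch (+-monoʳ-< a i<L))

  ◂-chain : ∀ {g L} → Arc D w (g 0) → Chain g L → Chain (w ◂ g) (suc L)
  ◂-chain w→g₀ ch {zero}  _         = w→g₀
  ◂-chain w→g₀ ch {suc i} (s≤s i<L) = ch i<L

  snoc-chain : ∀ {g L} → Chain g L → Arc D (g L) w → Chain (snoc g L w) (suc L)
  snoc-chain {w} {g} {L} ch g_L→w {i} (s≤s i≤L) with m≤n⇒m<n∨m≡n i≤L
  ... | inj₁ i<L = subst₂ (Arc D) (sym (snoc-≤ g w i≤L)) (sym (snoc-≤ g w i<L)) (ch i<L)
  ... | inj₂ refl = subst₂ (Arc D) (sym (snoc-≤ g w ≤-refl)) (sym (snoc-last g L w)) g_L→w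

  chain⇒path : ∀ {f L} → InjectiveOn f L → Chain f L → Path D L (f 0) (f L)
  chain⇒path {f} {L} inj ch = record
    { vert  = λ i → f (toℕ i)
    ; inj   = λ {i} {j} eq → toℕ-injective (inj (≤-pred (toℕ<n i)) (≤-pred (toℕ<n j)) eq)
    ; start = refl
    ; end   = cong f (toℕ-fromℕ L)
    ; step  = λ i → subst (λ j → Arc D (f j) (f (suc (toℕ i)))) (sym (toℕ-inject₁ i)) (ch (toℕ<n i))
    }

  quasiTransitive-chord : ∀ {k f} → QuasiTransitive D k → InjectiveOn f k → Chain f k →
                          Arc D (f 0) (f k) ⊎ Arc D (f k) (f 0)
  quasiTransitive-chord qt inj ch = qt (chain⇒path inj ch)

  infixr 5 _∷_ _++_

  data Walk : Fin n → Fin n → ℕ → Set where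
    []  : Walk u u 0
    _∷_ : Arc D u w → Walk w v ℓ → Walk u v (suc ℓ)

  _++_ : Walk u w ℓ → Walk w v m → Walk u v (ℓ + m)
  []      ++ q = q
  (a ∷ p) ++ q = a ∷ (p ++ q)

  vertex : Walk u v ℓ → ℕ → Fin n
  vertex {u} _       zero    = u
  vertex {v = v} []  (suc _) = v
  vertex (_ ∷ p)     (suc i) = vertex p i

  vertex-last : (p : Walk u v ℓ) → vertex p ℓ ≡ v
  vertex-last []      = refl
  vertex-last (_ ∷ p) = vertex-last p

  vertex-chain : (p : Walk u v ℓ) → Chain (vertex p) ℓ
  vertex-chain (a ∷ p) {zero}  _         = a
  vertex-chain (a ∷ p) {suc i} (s≤s i<ℓ) = vertex-chain p i<ℓ

  take : (p : Walk u v ℓ) (t : ℕ) → t ≤ ℓ → Walk u (vertex p t) t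
  take p       zero    _         = []
  take (a ∷ p) (suc t) (s≤s t≤ℓ) = a ∷ take p t t≤ℓ

  drop : (p : Walk u v ℓ) (t : ℕ) → t ≤ ℓ → Walk (vertex p t) v (ℓ ∸ t)
  drop p       zero    _         = p
  drop (a ∷ p) (suc t) (s≤s t≤ℓ) = drop p t t≤ℓ

  walkAlong : (f : ℕ → Fin n) → (∀ i → Arc D (f i) (f (suc i))) → ∀ a d → Walk (f a) (f (d + a)) d
  walkAlong f step a zero    = []
  walkAlong f step a (suc d) =
    step a ∷ subst (λ j → Walk (f (suc a)) (f j) d) (+-suc d a) (walkAlong f step (suc a) d)

  walk? : ∀ ℓ u v → Dec (Walk u v ℓ)
  walk? zero    u v with u ≟ᶠ v
  ... | yes refl = yes []
  ... | no  u≢v  = no λ { [] → u≢v refl }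
  walk? (suc ℓ) u v with any? (λ w → T? (Digraph.arc D u w) ×-dec walk? ℓ w v)
  ... | yes (w , a , p) = yes (a ∷ p)
  ... | no  ∄w          = no λ { (a ∷ p) → ∄w (_ , a , p) }

  Shortest : Walk u v ℓ → Set
  Shortest {u} {v} {ℓ} _ = ∀ {m} → Walk u v m → ℓ ≤ m

  shortestWalk : Walk u v ℓ → Σ ℕ λ L → Σ (Walk u v L) Shortest
  shortestWalk {u} {v} {ℓ} = <-rec (λ ℓ → Walk u v ℓ → Σ ℕ λ L → Σ (Walk u v L) Shortest) step ℓ
    where
    step : ∀ ℓ → (∀ {m} → m < ℓ → Walk u v m → Σ ℕ λ L → Σ (Walk u v L) Shortest) →
           Walk u v ℓ → Σ ℕ λ L → Σ (Walk u v L) Shortest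
    step ℓ rec p with anyUpTo? (λ m → walk? m u v) ℓ
    ... | yes (m , m<ℓ , q) = rec m<ℓ q
    ... | no  ∄shorter      = ℓ , p , λ q → ≮⇒≥ (λ m<ℓ → ∄shorter (_ , m<ℓ , q))

  module Geodesic {L} (p : Walk u v L) (shortest : Shortest p) where

    shortcut : ∀ {i j m} → i ≤ j → j ≤ L → Walk (vertex p i) (vertex p j) m → j ≤ i + m
    shortcut {i} {j} {m} i≤j j≤L q = +-cancelʳ-≤ (L ∸ j) j (i + m) (begin
      j + (L ∸ j)        ≡⟨ m+[n∸m]≡n j≤L ⟩
      L                  ≤⟨ shortest (take p i (≤-trans i≤j j≤L) ++ q ++ drop p j j≤L) ⟩
      i + (m + (L ∸ j))  ≡⟨ +-assoc i m _ ⟨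
      i + m + (L ∸ j)    ∎)
      where open ≤-Reasoning

    vertex-repeat : ∀ {i j} → i ≤ j → j ≤ L → vertex p i ≡ vertex p j → j ≤ i
    vertex-repeat {i} i≤j j≤L eq =
      subst (_ ≤_) (+-identityʳ i) (shortcut i≤j j≤L (subst (λ y → Walk (vertex p i) y 0) eq []))

    vertex-injective : InjectiveOn (vertex p) L
    vertex-injective {i} {j} i≤L j≤L eq with ≤-total i j
    ... | inj₁ i≤j = ≤-antisym i≤j (vertex-repeat i≤j j≤L eq)
    ... | inj₂ j≤i = sym (≤-antisym j≤i (vertex-repeat j≤i i≤L (sym eq)))

    no-chord : ∀ {i j} → suc i < j → j ≤ L → ¬ Arc D (vertex p i) (vertex p j)
    no-chord {i} {j} 1+i<j j≤L a =
      <⇒≱ 1+i<j (subst (j ≤_) (+-comm i 1) (shortcut (<⇒≤ (<-trans (n<1+n i) 1+i<j)) j≤L (a ∷ [])))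

    take-shortest : ∀ {t} (t≤L : t ≤ L) → Shortest (take p t t≤L)
    take-shortest {t} t≤L {m} q = +-cancelʳ-≤ (L ∸ t) t m (begin
      t + (L ∸ t)  ≡⟨ m+[n∸m]≡n t≤L ⟩
      L            ≤⟨ shortest (q ++ drop p t t≤L) ⟩
      m + (L ∸ t)  ∎)
      where open ≤-Reasoning

    toPath : Path D L u v
    toPath = subst (Path D L u) (vertex-last p) (chain⇒path vertex-injective (vertex-chain p))

  path-length< : Path D ℓ u v → ℓ < n
  path-length< p = injective⇒≤ (Path.inj p)

  path⇒walk : Path D ℓ u v → Walk u v ℓ
  path⇒walk {zero}  p = subst₂ (λ a b → Walk a b 0) (Path.start p) (Path.end p) []
  path⇒walk {suc ℓ} p = subst (λ a → Arc D a _) start (step zero) ∷ path⇒walk tail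
    where
    open Path p
    tail : Path D ℓ (vert (suc zero)) _
    tail = record
      { vert = vert ∘ suc ; inj = Fin-suc-injective ∘ inj ; start = refl ; end = end ; step = step ∘ suc }

  _↝_ : Fin n → Fin n → Set
  u ↝ v = ∃ (Walk u v)

  ↝-refl : u ↝ u
  ↝-refl = 0 , []

  ↝-trans : u ↝ w → w ↝ v → u ↝ v
  ↝-trans (_ , p) (_ , q) = _ , p ++ q

  ↝⇒Reach : u ↝ v → Reach D u v
  ↝⇒Reach (_ , p) with shortestWalk p
  ... | L , q , shortest = L , Geodesic.toPath q shortest

  Reach⇒↝ : Reach D u v → u ↝ v
  Reach⇒↝ (ℓ , p) = ℓ , path⇒walk p

  _↝?_ : ∀ u v → Dec (u ↝ v)
  u ↝? v = map′ (λ (ℓ , _ , p) → ℓ , p) bounded (anyUpTo? (λ ℓ → walk? ℓ u v) n)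
    where
    bounded : u ↝ v → ∃ λ ℓ → ℓ < n × Walk u v ℓ
    bounded (_ , p) with shortestWalk p
    ... | L , q , shortest = L , path-length< (Geodesic.toPath q shortest) , q

  ancestors : Fin n → Subset n
  ancestors v = tabulate (λ w → isYes (w ↝? v))

  ∈-ancestors⁺ : w ↝ v → w ∈ ancestors v
  ∈-ancestors⁺ w↝v = ∈-tabulate⁺ (fromWitness w↝v)

  ∈-ancestors⁻ : w ∈ ancestors v → w ↝ v
  ∈-ancestors⁻ w∈ = toWitness (∈-tabulate⁻ w∈)

  ancestors-⊂ : w ↝ v → ¬ v ↝ w → ancestors w ⊂ ancestors v
  ancestors-⊂ {v = v} w↝v v↝̸w =
    (λ u∈ → ∈-ancestors⁺ (↝-trans (∈-ancestors⁻ u∈) w↝v)) ,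
    v , ∈-ancestors⁺ ↝-refl , v↝̸w ∘ ∈-ancestors⁻

  ancestors-isInitialStrongComponent : (∀ {w} → w ↝ v → v ↝ w) →
                                       IsInitialStrongComponent D (ancestors v)
  ancestors-isInitialStrongComponent {v} back =
    ((v , ∈-ancestors⁺ ↝-refl) , strong , closed) , initial
    where
    strong : ∀ {a b} → a ∈ ancestors v → b ∈ ancestors v → Reach D a b
    strong a∈ b∈ = ↝⇒Reach (↝-trans (∈-ancestors⁻ a∈) (back (∈-ancestors⁻ b∈)))
    closed : ∀ {a b} → a ∈ ancestors v → Reach D a b → Reach D b a → b ∈ ancestors v
    closed a∈ _ b→a = ∈-ancestors⁺ (↝-trans (Reach⇒↝ b→a) (∈-ancestors⁻ a∈))
    initial : ∀ {a b} → a ∉ ancestors v → b ∈ ancestors v → Arc D a b → ⊥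
    initial a∉ b∈ a→b = a∉ (∈-ancestors⁺ (↝-trans (1 , a→b ∷ []) (∈-ancestors⁻ b∈)))

  initialStrongComponent-↝ : ∀ v → ∃ λ C → IsInitialStrongComponent D C × ∃ λ w → w ∈ C × w ↝ v
  initialStrongComponent-↝ = All.wfRec (On.wellFounded (∣_∣ ∘ ancestors) <-wellFounded) 0ℓ _ step
    where
    step : ∀ v → (∀ {w} → ∣ ancestors w ∣ < ∣ ancestors v ∣ →
                   ∃ λ C → IsInitialStrongComponent D C × ∃ λ u → u ∈ C × u ↝ w) →
           ∃ λ C → IsInitialStrongComponent D C × ∃ λ w → w ∈ C × w ↝ v
    step v rec with any? (λ w → (w ↝? v) ×-dec ¬? (v ↝? w))
    ... | yes (w , w↝v , v↝̸w) =
      let C , initial , u , u∈C , u↝w = rec (p⊂q⇒∣p∣<∣q∣ (ancestors-⊂ w↝v v↝̸w))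
      in C , initial , u , u∈C , ↝-trans u↝w w↝v
    ... | no ∄w =
      ancestors v , ancestors-isInitialStrongComponent back , v , ∈-ancestors⁺ ↝-refl , ↝-refl
      where
      back : ∀ {w} → w ↝ v → v ↝ w
      back {w} w↝v = decidable-stable (v ↝? w) λ v↝̸w → ∄w (w , w↝v , v↝̸w)

  uniqueInitialStrongComponent-↝ : ∀ {C} → UniqueInitialStrongComponent D C → v ∈ C → ∀ u → v ↝ u
  uniqueInitialStrongComponent-↝ {C = C} ((((_ , strong , _) , _)) , unique) v∈C u
    with initialStrongComponent-↝ u
  ... | C′ , initial , w , w∈C′ , w↝u =
    ↝-trans (Reach⇒↝ (strong v∈C (subst (w ∈_) (unique C′ initial) w∈C′))) w↝u

  ReachClosed : Subset n → Set
  ReachClosed C = ∀ {a b} → a ∈ C → Reach D a b → Reach D b a → b ∈ C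

  module FarVertex (m q : ℕ) (k≡q*2 : 2 + m ≡ q * 2) (qt : QuasiTransitive D (2 + m))
                   {v W : Fin n} (p : Walk v W (4 + m)) (shortest : Shortest p) where

    open Geodesic p shortest

    k N L : ℕ
    k = 2 + m
    N = suc k
    L = 2 + k

    k≤L : k ≤ L
    k≤L = m≤n+m k 2

    x : ℕ → Fin n
    x = vertex p

    x-last : x L ≡ W
    x-last = vertex-last p

    x-back : Arc D (x k) (x 0)
    x-back
      with quasiTransitive-chord qt (injectiveOn-≤ k≤L vertex-injective) (chain-≤ k≤L (vertex-chain p))
    ... | inj₁ x₀→x_k = contradiction x₀→x_k (no-chord (s≤s (s≤s z≤n)) k≤L)
    ... | inj₂ x_k→x₀ = x_k→x₀

    W→x₂ : Arc D W (x 2)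
    W→x₂
      with quasiTransitive-chord qt (injectiveOn-shift 2 vertex-injective) (chain-shift 2 (vertex-chain p))
    ... | inj₁ x₂→W = contradiction x₂→W (no-chord (m≤m+n 4 m) ≤-refl)
    ... | inj₂ W→x₂ = subst (λ w → Arc D w (x 2)) x-last W→x₂

    c : ℕ → Fin n
    c t = x (t % N)

    c-≤ : ∀ {t} → t ≤ k → c t ≡ x t
    c-≤ t≤k = cong x (m≤n⇒m%n≡m t≤k)

    c-% : ∀ t → c (t % N) ≡ c t
    c-% t = cong x (m%n%n≡m%n t N)

    c-period : ∀ {s t} → s ≡ t + N → c s ≡ c t
    c-period {t = t} refl = cong x ([m+n]%n≡m%n t N)

    c-suc-% : ∀ t → c (suc t) ≡ c (suc (t % N))
    c-suc-% t = cong x (begin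
      (1 + t) % N              ≡⟨ %-distribˡ-+ 1 t N ⟩
      (1 % N + t % N) % N      ≡⟨ cong (λ r → (1 % N + r) % N) (m%n%n≡m%n t N) ⟨
      (1 % N + t % N % N) % N  ≡⟨ %-distribˡ-+ 1 (t % N) N ⟨
      (1 + t % N) % N          ∎)
      where open ≡-Reasoning

    %N≤k : ∀ t → t % N ≤ k
    %N≤k t = ≤-pred (m%n<n t N)

    %N≤L : ∀ t → t % N ≤ L
    %N≤L t = ≤-trans (%N≤k t) k≤L

    cycle-step : ∀ {r} → r ≤ k → Arc D (c r) (c (suc r))
    cycle-step {r} r≤k with m≤n⇒m<n∨m≡n r≤k
    ... | inj₁ r<k  = subst₂ (Arc D) (sym (c-≤ r≤k)) (sym (c-≤ r<k)) (vertex-chain p (≤-trans r<k k≤L))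
    ... | inj₂ refl = subst₂ (Arc D) (sym (c-≤ ≤-refl)) (sym (c-period {t = 0} refl)) x-back

    c-step : ∀ t → Arc D (c t) (c (suc t))
    c-step t = subst₂ (Arc D) (c-% t) (sym (c-suc-% t)) (cycle-step (%N≤k t))

    c-residue-injective : ∀ s t → c s ≡ c t → s % N ≡ t % N
    c-residue-injective s t = vertex-injective (%N≤L s) (%N≤L t)

    c-chain : ∀ a {M} → Chain (λ i → c (i + a)) M
    c-chain a {_} {i} _ = c-step (i + a)

    c-window : ∀ a {i j} → i ≤ j → j ≤ k → c (i + a) ≡ c (j + a) → i ≡ j
    c-window a {i} {j} i≤j j≤k eq = +-cancelʳ-≡ a i j
      (%-injectiveOnWindow (+-monoˡ-≤ a i≤j) j+a<i+a+N (c-residue-injective (i + a) (j + a) eq))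
      where
      j+a<i+a+N : j + a < i + a + N
      j+a<i+a+N = ≤-trans (s≤s (+-mono-≤ j≤k (m≤n+m a i))) (≤-reflexive (+-comm N (i + a)))

    c-injectiveOn : ∀ a → InjectiveOn (λ i → c (i + a)) k
    c-injectiveOn a {i} {j} i≤k j≤k eq with ≤-total i j
    ... | inj₁ i≤j = c-window a i≤j j≤k eq
    ... | inj₂ j≤i = sym (c-window a j≤i i≤k (sym eq))

    W≢c : ∀ t → W ≢ c t
    W≢c t W≡c = <⇒≢ (s≤s (≤-trans (%N≤k t) (n≤1+n k)))
      (sym (vertex-injective ≤-refl (%N≤L t) (trans x-last W≡c)))

    c↛W : ∀ t → ¬ Arc D (c t) W
    c↛W t c→W = no-chord (s≤s (s≤s (%N≤k t))) ≤-refl (subst (Arc D (c t)) (sym x-last) c→W)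

    wrap : ∀ j → suc m + (2 + j) ≡ j + N
    wrap j = begin
      suc m + (2 + j)  ≡⟨ +-assoc (suc m) 2 j ⟨
      suc m + 2 + j    ≡⟨ cong (_+ j) (+-comm (suc m) 2) ⟩
      N + j            ≡⟨ +-comm N j ⟩
      j + N            ∎
      where open ≡-Reasoning

    -- Quasi-transitivity on the path W, c (2 + j), …, c (j + k + 1) = c j.
    W→c-descent : ∀ j → Arc D W (c (2 + j)) → Arc D W (c j)
    W→c-descent j W→c₂₊ⱼ
      with quasiTransitive-chord qt
             (◂-injectiveOn (λ {i} _ → W≢c (i + (2 + j)))
                            (injectiveOn-≤ (n≤1+n (suc m)) (c-injectiveOn (2 + j))))
             (◂-chain W→c₂₊ⱼ (c-chain (2 + j)))
    ... | inj₁ W→c = subst (Arc D W) (c-period (wrap j)) W→c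
    ... | inj₂ c→W = contradiction c→W (c↛W (suc m + (2 + j)))

    W→c-descent* : ∀ d j → Arc D W (c (d * 2 + j)) → Arc D W (c j)
    W→c-descent* zero    j W→c = W→c
    W→c-descent* (suc d) j W→c = W→c-descent* d j (W→c-descent (d * 2 + j) W→c)

    W→v : Arc D W v
    W→v = W→c-descent 0 (subst (Arc D W) (sym (c-≤ (m≤m+n 2 m))) W→x₂)

    W→c : ∀ t → Arc D W (c t)
    W→c zero    = W→v
    W→c (suc t) = W→c-descent* q (suc t) (subst (Arc D W) (sym (c-period odd)) (W→c t))
      where
      -- k + 1 = 2q + 1 is odd: one step forward around the cycle is q double steps back.
      odd : q * 2 + suc t ≡ t + N
      odd = trans (+-suc (q * 2) t) (trans (cong (λ z → suc (z + t)) (sym k≡q*2)) (+-comm N t))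

    v↛W : ¬ Arc D v W
    v↛W v→W = <⇒≱ (s≤s (s≤s z≤n)) (shortest (v→W ∷ []))

    -- Quasi-transitivity on the path W, x₃, …, x_k, x₀ = v, y.
    module OffCycle {y} (v→y : Arc D v y) (c≢y : ∀ t → c t ≢ y) where

      g : ℕ → Fin n
      g = snoc (λ i → c (i + 3)) m y

      W∉g : ∀ {i} → i ≤ suc m → W ≢ g i
      W∉g i≤ = snoc-elim (W ≢_) i≤ (λ {j} _ → W≢c (j + 3))
                                    (λ W≡y → v↛W (subst (Arc D v) (sym W≡y) v→y))

      g-injective : InjectiveOn g (suc m)
      g-injective = snoc-injectiveOn (λ {i} _ → c≢y (i + 3)) (injectiveOn-≤ (m≤n+m m 2) (c-injectiveOn 3))

      W→g₀ : Arc D W (g 0)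
      W→g₀ = subst (Arc D W) (sym (snoc-≤ (λ i → c (i + 3)) {m} y z≤n)) (W→c 3)

      g-chain : Chain g (suc m)
      g-chain = snoc-chain (c-chain 3) (subst (λ z → Arc D z y) v≡c[m+3] v→y)
        where
        v≡c[m+3] : v ≡ c (m + 3)
        v≡c[m+3] = sym (c-period {t = 0} (+-comm m 3))

      W→y : Arc D W y
      W→y with quasiTransitive-chord qt (◂-injectiveOn W∉g g-injective) (◂-chain W→g₀ g-chain)
      ... | inj₁ W→g = subst (Arc D W) (snoc-last _ m y) W→g
      ... | inj₂ g→W = contradiction (shortest (v→y ∷ y→W ∷ [])) (<⇒≱ (s≤s (s≤s (s≤s z≤n))))
        where
        y→W : Arc D y W
        y→W = subst (λ z → Arc D z W) (snoc-last _ m y) g→W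

    W→outNeighbour : ∀ {y} → Arc D v y → Arc D W y
    W→outNeighbour {y} v→y with anyUpTo? (λ t → c t ≟ᶠ y) N
    ... | yes (t , _ , c≡y) = subst (Arc D W) c≡y (W→c t)
    ... | no  y∉c           =
      OffCycle.W→y v→y (λ t c≡y → y∉c (t % N , m%n<n t N , trans (c-% t) c≡y))

    v↛c : ∀ {i} → i < k → ¬ Arc D v (c (i + 2))
    v↛c {i} i<k v→c with m≤n⇒m<n∨m≡n (≤-pred i<k)
    ... | inj₁ (s≤s i≤m) = no-chord (m≤n+m 2 i) i+2≤L (subst (Arc D v) (c-≤ i+2≤k) v→c)
      where
      i+2≤k : i + 2 ≤ k
      i+2≤k = ≤-trans (+-monoˡ-≤ 2 i≤m) (≤-reflexive (+-comm m 2))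
      i+2≤L : i + 2 ≤ L
      i+2≤L = ≤-trans i+2≤k k≤L
    ... | inj₂ refl =
      subst T (Digraph.loopless D v) (subst (Arc D v) (c-period {t = 0} (+-comm (suc m) 2)) v→c)

    module _ {C : Subset n} (closed : ReachClosed C) (v∈C : v ∈ C) where

      v↝c : ∀ t → Walk v (c t) t
      v↝c t = subst (λ s → Walk v (c s) t) (+-identityʳ t) (walkAlong c c-step 0 t)

      c↝v : ∀ t → Walk (c t) v (t * k)
      c↝v t = subst (λ s → Walk (c t) s (t * k)) closes (walkAlong c c-step t (t * k))
        where
        closes : c (t * k + t) ≡ v
        closes = cong x (trans (cong (_% N) (trans (+-comm (t * k) t) (sym (*-suc t k))))
                               (m*n%n≡0 t N))

      c∈C : ∀ t → c t ∈ C
      c∈C t = closed v∈C (↝⇒Reach (_ , v↝c t)) (↝⇒Reach (_ , c↝v t))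

      W∈C : W ∈ C
      W∈C = closed v∈C (↝⇒Reach (_ , p)) (↝⇒Reach (_ , W→v ∷ []))

      outDegIn[v]+k≤outDegIn[W] : outDegIn D C v + k ≤ outDegIn D C W
      outDegIn[v]+k≤outDegIn[W] = ∣p∣+m≤∣q∣ k (λ i → c (i + 2)) N⁺v⊆N⁺W c∈N⁺W c∉N⁺v
                             (λ i<k j<k → c-injectiveOn 2 (<⇒≤ i<k) (<⇒≤ j<k))
        where
        N⁺v⊆N⁺W : C ∩ OutNbhd D v ⊆ C ∩ OutNbhd D W
        N⁺v⊆N⁺W y∈ with x∈p∩q⁻ C _ y∈
        ... | y∈C , v→y = x∈p∩q⁺ (y∈C , ∈-tabulate⁺ (W→outNeighbour (∈-tabulate⁻ v→y)))
        c∈N⁺W : ∀ {i} → i < k → c (i + 2) ∈ C ∩ OutNbhd D W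
        c∈N⁺W {i} _ = x∈p∩q⁺ (c∈C (i + 2) , ∈-tabulate⁺ (W→c (i + 2)))
        c∉N⁺v : ∀ {i} → i < k → c (i + 2) ∉ C ∩ OutNbhd D v
        c∉N⁺v i<k c∈ = v↛c i<k (∈-tabulate⁻ (proj₂ (x∈p∩q⁻ C _ c∈)))

  distance≤k+1 : ∀ m q → 2 + m ≡ q * 2 → QuasiTransitive D (2 + m) →
                 ∀ {C v} → ReachClosed C → v ∈ C → maxOutDegIn D C < outDegIn D C v + (2 + m) →
                 ∀ {u L} (p : Walk v u L) → Shortest p → L ≤ 2 + m + 1
  distance≤k+1 m q k≡q*2 qt {C} {v} closed v∈C Δ<d+k {L = L} p shortest with L ≤? 2 + m + 1
  ... | yes L≤k+1 = L≤k+1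
  ... | no  L≰k+1 = contradiction Δ<d+k (≤⇒≯ (begin
    outDegIn D C v + (2 + m)          ≤⟨ outDegIn[v]+k≤outDegIn[W] closed v∈C ⟩
    outDegIn D C (vertex p (4 + m))   ≤⟨ outDegIn≤maxOutDegIn D C (W∈C closed v∈C) ⟩
    maxOutDegIn D C                   ∎))
    where
    open ≤-Reasoning
    L≥k+2 : 4 + m ≤ L
    L≥k+2 = subst (_≤ L) (cong (3 +_) (+-comm m 1)) (≰⇒> L≰k+1)
    open FarVertex m q k≡q*2 qt (take p (4 + m) L≥k+2) (Geodesic.take-shortest p shortest L≥k+2)

mainTheorem2 : ∀ {n : ℕ} (D : Digraph n) (k : ℕ) → 2 ≤ k → 2 ∣ k →
    QuasiTransitive D k →
    (C : Subset n) → UniqueInitialStrongComponent D C →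
    (v : Fin n) → v ∈ C →
    outDegIn D C v ≤ maxOutDegIn D C →
    maxOutDegIn D C < outDegIn D C v + k →
    King D (k + 1) v
mainTheorem2 D _ (s≤s (s≤s {n = m} z≤n)) (divides q k≡q*2) qt C unique v v∈C _ Δ<d+k u
  with shortestWalk D (proj₂ (uniqueInitialStrongComponent-↝ D unique v∈C u))
... | L , p , shortest =
  L , distance≤k+1 D m q k≡q*2 qt closed v∈C Δ<d+k p shortest , Geodesic.toPath D p shortest
  where
  closed : ReachClosed D C
  closed = proj₂ (proj₂ (proj₁ (proj₁ unique)))
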